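{- Let $(M_n)_{n\ge 1}$ be a sequence of real numbers (e.g. the moments of a probability measure on $\mathbb{R}$), and let $\phi:\mathrm{Sym}\to\mathbb{R}$ be the ring homomorphism with $\phi(h_n)=M_n$ for all $n\ge1$. Let $\psi(u)=u+O(u^2)$ be the formal power series that is the compositional inverse of $w\mapsto w\bigl(1+\sum_{n\ge1}M_nw^n\bigr)$, and define the free cumulants $R_n$ by the formal Laurent expansion $$\frac{1}{\psi(u)}=u^{ -1}+\sum_{n\ge1}R_n u^{n-1}$$ (equivalently, $K(u)=u^{ -1}+\sum_{n\ge 1}R_nu^{n-1}$ is the compositional inverse of $G(z)=z^{ -1}+\sum_{n\ge1}M_nz^{ -n-1}$). Then for every $n\ge1$, $$R_n=(-1)^n\,\phi(e_n^*).$$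
   Context: $\mathrm{Sym}=\mathbb{Q}[h_1,h_2,\dots]$ is the ring of symmetric functions, with complete homogeneous functions $h_n$ and elementary functions $e_n$, related by $\bigl(\sum_{n\ge0}(-1)^ne_nt^n\bigr)\bigl(\sum_{n\ge0}h_nt^n\bigr)=1$. Define $h_n^*\in\mathrm{Sym}$ ($h_0^*=1$) by the formal power series identity: with $H(t)=\sum_{n\ge0}h_nt^n$ and $H^*(u)=\sum_{n\ge0}h_n^*u^n$, one has $u=tH(t)\iff t=uH^*(u)$ (i.e. $uH^*(u)$ is the compositional inverse of $tH(t)$). Let $f\mapsto f^*$ be the ring endomorphism of $\mathrm{Sym}$ sending $h_n\mapsto h_n^*$ for all $n\ge1$, and let $e_n^*$ denote the image of $e_n$ under it. -}

module Defs where

open import Level using (0ℓ)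
open import Data.Nat using (ℕ; zero; suc; _∸_)
open import Algebra.Bundles using (CommutativeRing)
open import Data.Product using (_×_)

-- Generic (formal power series) operations over raw ring operations.
-- A power series is its coefficient sequence  ℕ → A  (coefficient of t^n).

module Series {A : Set} (_+_ _*_ : A → A → A) (-_ : A → A) (0# 1# : A) where

  Σ≤ : ℕ → (ℕ → A) → A
  Σ≤ zero    f = f zero
  Σ≤ (suc n) f = Σ≤ n f + f (suc n)

  sgn : ℕ → A → A
  sgn zero    x = x
  sgn (suc n) x = - sgn n x

  𝟙 : ℕ → A
  𝟙 zero    = 1#
  𝟙 (suc n) = 0#

  X : ℕ → A
  X zero          = 0#
  X (suc zero)    = 1#
  X (suc (suc n)) = 0#

  _·_ : (ℕ → A) → (ℕ → A) → (ℕ → A)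
  (a · b) n = Σ≤ n (λ i → a i * b (n ∸ i))

  pow : (ℕ → A) → ℕ → (ℕ → A)
  pow a zero    = 𝟙
  pow a (suc k) = a · pow a k

  -- composition F(G(t)), meaningful when G has zero constant term
  _∘ₛ_ : (ℕ → A) → (ℕ → A) → (ℕ → A)
  (F ∘ₛ G) n = Σ≤ n (λ k → F k * pow G k n)

-- Sym = ℚ[h₁,h₂,…]: elements are represented by polynomial expressions
-- in the h_n; equality of Sym is identity of polynomials (see _≈S_).

infixl 6 _⊕_
infixl 7 _⊗_
infix  8 ⊖_

data SymE : Set where
  h₊  : ℕ → SymE          -- h₊ n is h_{n+1}
  𝟎 𝟏 : SymE
  _⊕_ : SymE → SymE → SymE
  _⊗_ : SymE → SymE → SymE
  ⊖_  : SymE → SymE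

h : ℕ → SymE
h zero    = 𝟏
h (suc n) = h₊ n

eval : (R : CommutativeRing 0ℓ 0ℓ) → (ℕ → CommutativeRing.Carrier R) → SymE → CommutativeRing.Carrier R
eval R x (h₊ n)  = x n
eval R x 𝟎       = CommutativeRing.0# R
eval R x 𝟏       = CommutativeRing.1# R
eval R x (a ⊕ b) = CommutativeRing._+_ R (eval R x a) (eval R x b)
eval R x (a ⊗ b) = CommutativeRing._*_ R (eval R x a) (eval R x b)
eval R x (⊖ a)   = CommutativeRing.-_ R (eval R x a)

-- equality in Sym: equality as polynomials in the h_n, i.e. equal
-- values under every ring homomorphism to every commutative ring
infix 4 _≈S_
_≈S_ : SymE → SymE → Set₁
a ≈S b = (R : CommutativeRing 0ℓ 0ℓ) (x : ℕ → CommutativeRing.Carrier R) →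
         CommutativeRing._≈_ R (eval R x a) (eval R x b)

substS : (ℕ → SymE) → SymE → SymE
substS σ (h₊ n)  = σ n
substS σ 𝟎       = 𝟎
substS σ 𝟏       = 𝟏
substS σ (a ⊕ b) = substS σ a ⊕ substS σ b
substS σ (a ⊗ b) = substS σ a ⊗ substS σ b
substS σ (⊖ a)   = ⊖ substS σ a

module SymSeries = Series _⊕_ _⊗_ ⊖_ 𝟎 𝟏

-- tH(t) for a sequence g with g 0 = 1: coefficients 0, g 0, g 1, …
shiftS : (ℕ → SymE) → (ℕ → SymE)
shiftS g zero    = 𝟎
shiftS g (suc n) = g n

-- IsElementary e : e is the sequence of elementary symmetric functions
-- e_0, e_1, …, i.e.  e_0 = 1 and (Σ (-1)^n e_n t^n)(Σ h_n t^n) = 1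
IsElementary : (ℕ → SymE) → Set₁
IsElementary e = (e 0 ≈S 𝟏) × (∀ n → ((λ k → sgn k (e k)) · h) (suc n) ≈S 𝟎)
  where open SymSeries

-- IsHStar hs : hs n = h*_n, i.e. hs 0 = 1 and u H*(u) is the compositional
-- inverse of t H(t):  (tH(t)) ∘ (uH*(u)) = u
IsHStar : (ℕ → SymE) → Set₁
IsHStar hs = (hs 0 ≈S 𝟏) × (∀ n → (shiftS h ∘ₛ shiftS hs) n ≈S X n)
  where open SymSeries

star : (ℕ → SymE) → SymE → SymE
star hs = substS (λ n → hs (suc n))

module Target (R : CommutativeRing 0ℓ 0ℓ) where
  open CommutativeRing R public
  open Series _+_ _*_ -_ 0# 1# public

  -- φ : Sym → R, h_n ↦ M n  (n ≥ 1;  M 0 is unused)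
  φ : (ℕ → Carrier) → SymE → Carrier
  φ M = eval R (λ n → M (suc n))

  -- coefficients of w ↦ w (1 + Σ_{n≥1} M_n w^n)
  Fser : (ℕ → Carrier) → (ℕ → Carrier)
  Fser M zero          = 0#
  Fser M (suc zero)    = 1#
  Fser M (suc (suc n)) = M (suc n)

  IsInverse : (ℕ → Carrier) → (ℕ → Carrier) → Set
  IsInverse M ψ = (ψ 0 ≈ 0#) × (ψ 1 ≈ 1#) × (∀ n → (Fser M ∘ₛ ψ) n ≈ X n)

  -- 1/ψ(u) = u⁻¹ + Σ_{n≥1} Rc_n u^{n-1}, written without Laurent series as
  -- ψ(u) · (u⁻¹ + Σ Rc_n u^{n-1}) = 1, i.e. (ψ(u)/u)(1 + Σ_{n≥1} Rc_n u^n) = 1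
  -- (Rc 0 is unused)
  IsFreeCumulants : (ℕ → Carrier) → (ℕ → Carrier) → Set
  IsFreeCumulants ψ Rc = ∀ n → ((λ k → ψ (suc k)) · K) n ≈ 𝟙 n
    where
      K : ℕ → Carrier
      K zero    = 1#
      K (suc n) = Rc (suc n)

-- Under φ the series t H(t) becomes w (1 + Σ M_n w^n), so the image of u H*(u)
-- is the compositional inverse ψ; compositional inverses are unique.  Hence
-- ψ(u)/u is the image of H*(u), whose multiplicative inverse is the image of
-- E*(-u) = Σ (-1)^n e*_n u^n by the starred relation E(-t) H(t) = 1.  As
-- 1 + Σ R_n u^n is also inverse to ψ(u)/u, R_n = (-1)^n φ(e*_n).
module Submission where

open import Defs
open import Level using (0ℓ)
open import Data.Nat using (ℕ; zero; suc; _∸_; _≤_; _<_; z≤n; s≤s)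
open import Data.Nat.Properties
  using (≤-refl; ≤-trans; ≤-<-trans; m≤n⇒m≤1+n; m≤n⇒m<n∨m≡n; m∸n≤m; n∸n≡0; m∸[m∸n]≡n; ∸-monoʳ-<)
open import Data.Nat.Induction using (<-rec)
open import Data.Product using (_,_; proj₁; proj₂)
open import Data.Sum using (inj₁; inj₂)
open import Algebra.Bundles using (CommutativeRing)
import Algebra.Properties.Group as GroupProperties
open import Relation.Binary.PropositionalEquality as P using (_≡_)
import Relation.Binary.Reasoning.Setoid as SetoidReasoning

module FormalPowerSeries (R : CommutativeRing 0ℓ 0ℓ) where
  open Target R
  open SetoidReasoning setoid
  open GroupProperties +-group using (∙-cancelʳ)

  Σ≤-cong : ∀ n {f g : ℕ → Carrier} → (∀ i → i ≤ n → f i ≈ g i) → Σ≤ n f ≈ Σ≤ n g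
  Σ≤-cong zero    f≈g = f≈g 0 z≤n
  Σ≤-cong (suc n) f≈g =
    +-cong (Σ≤-cong n (λ i i≤n → f≈g i (m≤n⇒m≤1+n i≤n))) (f≈g (suc n) ≤-refl)

  Σ≤-zero : ∀ n {f : ℕ → Carrier} → (∀ i → i ≤ n → f i ≈ 0#) → Σ≤ n f ≈ 0#
  Σ≤-zero n f≈0 = trans (Σ≤-cong n f≈0) (zeros n)
    where
      zeros : ∀ n → Σ≤ n (λ _ → 0#) ≈ 0#
      zeros zero    = refl
      zeros (suc n) = trans (+-congʳ (zeros n)) (+-identityʳ 0#)

  Σ≤-unfoldˡ : ∀ n f → Σ≤ (suc n) f ≈ f 0 + Σ≤ n (λ i → f (suc i))
  Σ≤-unfoldˡ zero    f = refl
  Σ≤-unfoldˡ (suc n) f = trans (+-congʳ (Σ≤-unfoldˡ n f)) (+-assoc _ _ _)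

  Σ≤-reverse : ∀ n f → Σ≤ n f ≈ Σ≤ n (λ i → f (n ∸ i))
  Σ≤-reverse zero    f = refl
  Σ≤-reverse (suc n) f = begin
    Σ≤ n f + f (suc n)                              ≈⟨ +-congʳ (Σ≤-reverse n f) ⟩
    Σ≤ n (λ i → f (n ∸ i)) + f (suc n)              ≈⟨ +-comm _ _ ⟩
    f (suc n) + Σ≤ n (λ i → f (n ∸ i))              ≈⟨ Σ≤-unfoldˡ n (λ i → f (suc n ∸ i)) ⟨
    Σ≤ (suc n) (λ i → f (suc n ∸ i))                ∎

  ·-cong : ∀ {a a′ b b′} → (∀ i → a i ≈ a′ i) → (∀ i → b i ≈ b′ i) →
           ∀ n → (a · b) n ≈ (a′ · b′) n
  ·-cong a≈a′ b≈b′ n = Σ≤-cong n (λ i _ → *-cong (a≈a′ i) (b≈b′ (n ∸ i)))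

  ·-comm : ∀ a b n → (a · b) n ≈ (b · a) n
  ·-comm a b n = trans (Σ≤-reverse n _) (Σ≤-cong n λ i i≤n →
    trans (*-comm _ _) (*-congʳ (reflexive (P.cong b (m∸[m∸n]≡n i≤n)))))

  ·-identityˡ : ∀ a n → (𝟙 · a) n ≈ a n
  ·-identityˡ a zero    = *-identityˡ (a 0)
  ·-identityˡ a (suc n) = begin
    (𝟙 · a) (suc n)                              ≈⟨ Σ≤-unfoldˡ n _ ⟩
    1# * a (suc n) + Σ≤ n (λ i → 0# * _)         ≈⟨ +-cong (*-identityˡ _) (Σ≤-zero n (λ _ _ → zeroˡ _)) ⟩
    a (suc n) + 0#                               ≈⟨ +-identityʳ _ ⟩
    a (suc n)                                    ∎

  ·-identityʳ : ∀ a n → (a · 𝟙) n ≈ a n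
  ·-identityʳ a n = trans (·-comm a 𝟙 n) (·-identityˡ a n)

  ·-unfold-monic : ∀ {p} → p 0 ≈ 1# → ∀ a n →
                   (p · a) (suc n) ≈ a (suc n) + Σ≤ n (λ i → p (suc i) * a (n ∸ i))
  ·-unfold-monic p₀ a n =
    trans (Σ≤-unfoldˡ n _) (+-congʳ (trans (*-congʳ p₀) (*-identityˡ _)))

  ·-cancelˡ : ∀ {p a b} → p 0 ≈ 1# → (∀ n → (p · a) n ≈ (p · b) n) → ∀ n → a n ≈ b n
  ·-cancelˡ {p} {a} {b} p₀ pa≈pb = <-rec _ step
    where
      step : ∀ n → (∀ {m} → m < n → a m ≈ b m) → a n ≈ b n
      step zero    _  = begin
        a 0          ≈⟨ trans (*-congʳ p₀) (*-identityˡ _) ⟨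
        p 0 * a 0    ≈⟨ pa≈pb 0 ⟩
        p 0 * b 0    ≈⟨ trans (*-congʳ p₀) (*-identityˡ _) ⟩
        b 0          ∎
      step (suc n) ih = ∙-cancelʳ _ _ _ (begin
        a (suc n) + Σ≤ n (λ i → p (suc i) * a (n ∸ i))  ≈⟨ ·-unfold-monic p₀ a n ⟨
        (p · a) (suc n)                                 ≈⟨ pa≈pb (suc n) ⟩
        (p · b) (suc n)                                 ≈⟨ ·-unfold-monic p₀ b n ⟩
        b (suc n) + Σ≤ n (λ i → p (suc i) * b (n ∸ i))  ≈⟨ +-congˡ (Σ≤-cong n λ i _ →
                                                             *-congˡ (sym (ih (s≤s (m∸n≤m n i))))) ⟩
        b (suc n) + Σ≤ n (λ i → p (suc i) * a (n ∸ i))  ∎)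

  pow-cong-≤ : ∀ {p q} k n → (∀ j → j ≤ n → p j ≈ q j) → pow p k n ≈ pow q k n
  pow-cong-≤ zero    n _   = refl
  pow-cong-≤ (suc k) n p≈q = Σ≤-cong n λ i i≤n →
    *-cong (p≈q i i≤n) (pow-cong-≤ k (n ∸ i) λ j j≤ → p≈q j (≤-trans j≤ (m∸n≤m n i)))

  -- From the second power on, every term of the n-th coefficient that involves
  -- p n also carries a factor p 0.
  pow-cong-< : ∀ {p q} → p 0 ≈ 0# → q 0 ≈ 0# → ∀ k n → (∀ j → j < n → p j ≈ q j) →
               pow p (suc (suc k)) n ≈ pow q (suc (suc k)) n
  pow-cong-< {p} {q} p₀ q₀ k n p≈q = Σ≤-cong n term
    where
      vanishes : ∀ {r} → r 0 ≈ 0# → ∀ i → i ≡ n → pow r (suc k) (n ∸ i) ≈ 0#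
      vanishes r₀ i P.refl = trans (reflexive (P.cong (pow _ (suc k)) (n∸n≡0 n)))
                                   (trans (*-congʳ r₀) (zeroˡ _))
      term : ∀ i → i ≤ n → p i * pow p (suc k) (n ∸ i) ≈ q i * pow q (suc k) (n ∸ i)
      term zero    _ = trans (trans (*-congʳ p₀) (zeroˡ _)) (sym (trans (*-congʳ q₀) (zeroˡ _)))
      term (suc i) i≤n with m≤n⇒m<n∨m≡n i≤n
      ... | inj₁ i<n = *-cong (p≈q (suc i) i<n)
                               (pow-cong-≤ (suc k) _ λ j j≤ → p≈q j (≤-<-trans j≤ (∸-monoʳ-< (s≤s z≤n) i≤n)))
      ... | inj₂ i≡n  = trans (trans (*-congˡ (vanishes p₀ _ i≡n)) (zeroʳ _))
                              (sym (trans (*-congˡ (vanishes q₀ _ i≡n)) (zeroʳ _)))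

  ∘ₛ-coeff-1 : ∀ {F} → F 1 ≈ 1# → ∀ p → (F ∘ₛ p) 1 ≈ p 1
  ∘ₛ-coeff-1 {F} F₁ p = begin
    F 0 * 0# + F 1 * (p 0 * 0# + p 1 * 1#)  ≈⟨ +-cong (zeroʳ _) (*-cong F₁ (+-cong (zeroʳ _) (*-identityʳ _))) ⟩
    0# + 1# * (0# + p 1)                     ≈⟨ trans (+-identityˡ _) (trans (*-identityˡ _) (+-identityˡ _)) ⟩
    p 1                                      ∎

  ∘ₛ-unfold : ∀ {F} → F 1 ≈ 1# → ∀ p m →
              (F ∘ₛ p) (suc (suc m)) ≈
              p (suc (suc m)) + Σ≤ m (λ k → F (suc (suc k)) * pow p (suc (suc k)) (suc (suc m)))
  ∘ₛ-unfold {F} F₁ p m = begin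
    (F ∘ₛ p) (suc (suc m))                            ≈⟨ Σ≤-unfoldˡ (suc m) _ ⟩
    F 0 * 0# + Σ≤ (suc m) (λ k → F (suc k) * _)        ≈⟨ +-cong (zeroʳ _) (Σ≤-unfoldˡ m _) ⟩
    0# + (F 1 * pow p 1 (suc (suc m)) + rest)         ≈⟨ +-identityˡ _ ⟩
    F 1 * pow p 1 (suc (suc m)) + rest                ≈⟨ +-congʳ (*-cong F₁ (·-identityʳ p _)) ⟩
    1# * p (suc (suc m)) + rest                       ≈⟨ +-congʳ (*-identityˡ _) ⟩
    p (suc (suc m)) + rest                            ∎
    where
      rest : Carrier
      rest = Σ≤ m (λ k → F (suc (suc k)) * pow p (suc (suc k)) (suc (suc m)))

  ∘ₛ-cancelˡ : ∀ {F p q} → F 1 ≈ 1# → p 0 ≈ 0# → q 0 ≈ 0# →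
               (∀ n → (F ∘ₛ p) n ≈ (F ∘ₛ q) n) → ∀ n → p n ≈ q n
  ∘ₛ-cancelˡ {F} {p} {q} F₁ p₀ q₀ Fp≈Fq = <-rec _ step
    where
      step : ∀ n → (∀ {m} → m < n → p m ≈ q m) → p n ≈ q n
      step zero          _  = trans p₀ (sym q₀)
      step (suc zero)    _  = trans (sym (∘ₛ-coeff-1 {F} F₁ p)) (trans (Fp≈Fq 1) (∘ₛ-coeff-1 {F} F₁ q))
      step (suc (suc m)) ih = ∙-cancelʳ _ _ _ (begin
        p (suc (suc m)) + rest p    ≈⟨ ∘ₛ-unfold F₁ p m ⟨
        (F ∘ₛ p) (suc (suc m))      ≈⟨ Fp≈Fq (suc (suc m)) ⟩
        (F ∘ₛ q) (suc (suc m))      ≈⟨ ∘ₛ-unfold F₁ q m ⟩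
        q (suc (suc m)) + rest q    ≈⟨ +-congˡ (Σ≤-cong m λ k _ →
                                         *-congˡ (sym (pow-cong-< p₀ q₀ k _ (λ j j< → ih j<)))) ⟩
        q (suc (suc m)) + rest p    ∎)
        where
          rest : (ℕ → Carrier) → Carrier
          rest r = Σ≤ m (λ k → F (suc (suc k)) * pow r (suc (suc k)) (suc (suc m)))

  sgn-cong : ∀ k {a b} → a ≈ b → sgn k a ≈ sgn k b
  sgn-cong zero    a≈b = a≈b
  sgn-cong (suc k) a≈b = -‿cong (sgn-cong k a≈b)

module Evaluation (R : CommutativeRing 0ℓ 0ℓ) (x : ℕ → CommutativeRing.Carrier R) where
  open Target R
  open FormalPowerSeries R
  open SetoidReasoning setoid
  module S = SymSeries

  ⟦_⟧ : SymE → Carrier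
  ⟦_⟧ = eval R x

  eval-Σ≤ : ∀ n f → ⟦ S.Σ≤ n f ⟧ ≈ Σ≤ n (λ i → ⟦ f i ⟧)
  eval-Σ≤ zero    f = refl
  eval-Σ≤ (suc n) f = +-congʳ (eval-Σ≤ n f)

  eval-𝟙 : ∀ n → ⟦ S.𝟙 n ⟧ ≈ 𝟙 n
  eval-𝟙 zero    = refl
  eval-𝟙 (suc n) = refl

  eval-X : ∀ n → ⟦ S.X n ⟧ ≈ X n
  eval-X zero          = refl
  eval-X (suc zero)    = refl
  eval-X (suc (suc n)) = refl

  eval-sgn : ∀ k a → ⟦ S.sgn k a ⟧ ≈ sgn k ⟦ a ⟧
  eval-sgn zero    a = refl
  eval-sgn (suc k) a = -‿cong (eval-sgn k a)

  eval-· : ∀ a b n → ⟦ (a S.· b) n ⟧ ≈ ((λ i → ⟦ a i ⟧) · (λ i → ⟦ b i ⟧)) n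
  eval-· a b n = eval-Σ≤ n _

  eval-pow : ∀ a k n → ⟦ S.pow a k n ⟧ ≈ pow (λ i → ⟦ a i ⟧) k n
  eval-pow a zero    n = eval-𝟙 n
  eval-pow a (suc k) n = trans (eval-· a (S.pow a k) n) (·-cong (λ _ → refl) (λ m → eval-pow a k m) n)

  eval-∘ₛ : ∀ F G n → ⟦ (F S.∘ₛ G) n ⟧ ≈ ((λ i → ⟦ F i ⟧) ∘ₛ (λ i → ⟦ G i ⟧)) n
  eval-∘ₛ F G n = trans (eval-Σ≤ n _) (Σ≤-cong n λ k _ → *-congˡ (eval-pow G k n))

  eval-substS : ∀ σ a → ⟦ substS σ a ⟧ ≈ eval R (λ n → ⟦ σ n ⟧) a
  eval-substS σ (h₊ n)  = refl
  eval-substS σ 𝟎       = refl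
  eval-substS σ 𝟏       = refl
  eval-substS σ (a ⊕ b) = +-cong (eval-substS σ a) (eval-substS σ b)
  eval-substS σ (a ⊗ b) = *-cong (eval-substS σ a) (eval-substS σ b)
  eval-substS σ (⊖ a)   = -‿cong (eval-substS σ a)

  eval-elementary : ∀ {e} → IsElementary e → ∀ n →
                    ((λ i → sgn i ⟦ e i ⟧) · (λ i → ⟦ h i ⟧)) n ≈ 𝟙 n
  eval-elementary (e₀ , _) zero = trans (*-identityʳ _) (e₀ R x)
  eval-elementary {e} (_ , e-rec) (suc n) = begin
    ((λ i → sgn i ⟦ e i ⟧) · (λ i → ⟦ h i ⟧)) (suc n)        ≈⟨ ·-cong {b = λ i → ⟦ h i ⟧} (λ i → sym (eval-sgn i (e i))) (λ _ → refl) (suc n) ⟩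
    ((λ i → ⟦ S.sgn i (e i) ⟧) · (λ i → ⟦ h i ⟧)) (suc n)    ≈⟨ eval-· _ h (suc n) ⟨
    ⟦ ((λ i → S.sgn i (e i)) S.· h) (suc n) ⟧                ≈⟨ e-rec n R x ⟩
    0#                                                       ∎

  eval-hStar : ∀ {hs} → IsHStar hs → ∀ n →
               ((λ i → ⟦ shiftS h i ⟧) ∘ₛ (λ i → ⟦ shiftS hs i ⟧)) n ≈ X n
  eval-hStar {hs} (_ , hs-rec) n =
    trans (sym (eval-∘ₛ (shiftS h) (shiftS hs) n)) (trans (hs-rec n R x) (eval-X n))

module FreeCumulants (R : CommutativeRing 0ℓ 0ℓ) (M : ℕ → CommutativeRing.Carrier R)
                     (hs : ℕ → SymE) (isHStar : IsHStar hs)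
                     (ψ : ℕ → CommutativeRing.Carrier R) (isInverse : Target.IsInverse R M ψ) where
  open Target R
  open FormalPowerSeries R
  open Evaluation R (λ k → M (suc k)) using (eval-hStar)
  module Φ* = Evaluation R (λ k → φ M (hs (suc k)))
  open SetoidReasoning setoid

  ψ₀ : ψ 0 ≈ 0#
  ψ₀ = proj₁ isInverse

  ψ₁ : ψ 1 ≈ 1#
  ψ₁ = proj₁ (proj₂ isInverse)

  Fψ≈X : ∀ n → (Fser M ∘ₛ ψ) n ≈ X n
  Fψ≈X = proj₂ (proj₂ isInverse)

  φ[tH]≈Fser : ∀ i → φ M (shiftS h i) ≈ Fser M i
  φ[tH]≈Fser zero          = refl
  φ[tH]≈Fser (suc zero)    = refl
  φ[tH]≈Fser (suc (suc i)) = refl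

  ψ≈φ[uH*] : ∀ k → ψ k ≈ φ M (shiftS hs k)
  ψ≈φ[uH*] = ∘ₛ-cancelˡ {Fser M} refl ψ₀ refl λ k → begin
    (Fser M ∘ₛ ψ) k                                             ≈⟨ Fψ≈X k ⟩
    X k                                                         ≈⟨ eval-hStar isHStar k ⟨
    ((λ i → φ M (shiftS h i)) ∘ₛ (λ i → φ M (shiftS hs i))) k   ≈⟨ Σ≤-cong k (λ i _ → *-congʳ (φ[tH]≈Fser i)) ⟩
    (Fser M ∘ₛ (λ i → φ M (shiftS hs i))) k                     ∎

  ψ/u≈φ*[H] : ∀ k → ψ (suc k) ≈ Φ*.⟦ h k ⟧
  ψ/u≈φ*[H] zero    = ψ₁
  ψ/u≈φ*[H] (suc k) = ψ≈φ[uH*] (suc (suc k))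

  ψ/u·E*≈𝟙 : ∀ {e} → IsElementary e → ∀ k → ((λ i → ψ (suc i)) · (λ i → sgn i Φ*.⟦ e i ⟧)) k ≈ 𝟙 k
  ψ/u·E*≈𝟙 {e} isElementary k = begin
    ((λ i → ψ (suc i)) · E*) k      ≈⟨ ·-cong {b = E*} ψ/u≈φ*[H] (λ _ → refl) k ⟩
    ((λ i → Φ*.⟦ h i ⟧) · E*) k     ≈⟨ ·-comm _ E* k ⟩
    (E* · (λ i → Φ*.⟦ h i ⟧)) k     ≈⟨ Φ*.eval-elementary isElementary k ⟩
    𝟙 k                             ∎
    where
      E* : ℕ → Carrier
      E* i = sgn i Φ*.⟦ e i ⟧

  -- IsFreeCumulants names the series 1 + Σ R_n u^n in a where clause, so it is only
  -- reachable by unification: G m i is solved as its (m ∸ i)-th coefficient, for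
  -- which the antidiagonal hypothesis holds by refl.
  cumulants≈E* : ∀ {e} → IsElementary e → ∀ {G : ℕ → ℕ → Carrier} → (∀ m i → G m i ≈ G (m ∸ i) 0) →
                 (∀ m → Σ≤ m (λ i → ψ (suc i) * G m i) ≈ 𝟙 m) → ∀ k → G k 0 ≈ sgn k Φ*.⟦ e k ⟧
  cumulants≈E* isElementary G-antidiagonal ψ/u·G≈𝟙 = ·-cancelˡ ψ₁ λ m →
    trans (Σ≤-cong m λ i _ → *-congˡ (sym (G-antidiagonal m i)))
          (trans (ψ/u·G≈𝟙 m) (sym (ψ/u·E*≈𝟙 isElementary m)))

mainTheorem1 : (R : CommutativeRing 0ℓ 0ℓ) → let open Target R in
    (M : ℕ → Carrier) → (e hs : ℕ → SymE) → IsElementary e → IsHStar hs →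
    (ψ Rc : ℕ → Carrier) → IsInverse M ψ → IsFreeCumulants ψ Rc →
    ∀ n → Rc (suc n) ≈ sgn (suc n) (φ M (star hs (e (suc n))))
mainTheorem1 R M e hs isElementary isHStar ψ Rc isInverse cumulants n = begin
    Rc (suc n)                                ≈⟨ cumulants≈E* isElementary (λ _ _ → refl) cumulants (suc n) ⟩
    sgn (suc n) Φ*.⟦ e (suc n) ⟧              ≈⟨ sgn-cong (suc n) (eval-substS (λ k → hs (suc k)) (e (suc n))) ⟨
    sgn (suc n) (φ M (star hs (e (suc n))))   ∎
  where
    open Target R
    open FormalPowerSeries R using (sgn-cong)
    open Evaluation R (λ k → M (suc k)) using (eval-substS)
    open FreeCumulants R M hs isHStar ψ isInverse
    open SetoidReasoning setoid
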